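{- There are exactly $2^{\aleph_0}$ Epstein complete extensions of $\mathcal{F}$, i.e. there are $2^{\aleph_0}$ logics that are Epstein complete.
   Context: Let $\Phi=\{p_0,p_1,\dots\}$ be a countably infinite set of propositional letters; $\mathsf{FOR}$ is the set of formulas built from $\Phi$ with $\neg$ and binary $\lor,\wedge,\to,\leftrightarrow,\vartriangle,\looparrowright$. An Epstein model is $\langle v,\mathfrak{R}\rangle$ with $v:\Phi\to\{0,1\}$ and $\mathfrak{R}\subseteq\mathsf{FOR}^2$ (an Epstein relation). Truth: $\langle v,\mathfrak{R}\rangle\vDash p$ iff $v(p)=1$; classical clauses for $\neg,\wedge,\lor,\to,\leftrightarrow$; $\vDash\psi\vartriangle\chi$ iff both $\psi,\chi$ true and $\langle\psi,\chi\rangle\in\mathfrak{R}$; $\vDash\psi\looparrowright\chi$ iff ($\psi$ false or $\chi$ true) and $\langle\psi,\chi\rangle\in\mathfrak{R}$. For a relation, $\mathfrak{R}\vDash\varphi$ iff $\langle v,\mathfrak{R}\rangle\vDash\varphi$ for every valuation $v$; for a set $X$ of relations, $X\vDash\varphi$ iff $\mathfrak{R}\vDash\varphi$ for all $\mathfrak{R}\in X$. A substitution is an endomorphism of the formula algebra. $\mathcal{F}$ is the least set of formulas containing all classical tautologies (in this language), $(p\looparrowright q)\to(p\to q)$ and $(p\vartriangle q)\leftrightarrow((p\looparrowright q)\wedge(p\wedge q))$ (for distinct letters $p,q$), closed under uniform substitution and modus ponens. A logic is any set of formulas containing $\mathcal{F}$ closed under uniform substitution and modus ponens. A logic $\lambda$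 is Epstein complete iff there is a set $X$ of Epstein relations with $\lambda=\{\varphi:X\vDash\varphi\}$. -}

module Defs where

open import Level using (0ℓ)
open import Data.Nat using (ℕ)
open import Data.Bool using (Bool; true; false; not; _∧_; _∨_)
open import Data.Product using (Σ; Σ-syntax; _×_; _,_)
open import Data.Sum using (_⊎_)
open import Relation.Nullary using (¬_)
open import Relation.Binary.PropositionalEquality using (_≡_; _≢_)
open import Axiom.ExcludedMiddle using (ExcludedMiddle)

infixr 5 _⊻_ _⊼_
infixr 4 _⇒_ _⇔_
data Fm : Set where
  var  : ℕ → Fm
  ¬'   : Fm → Fm
  _⊼_  : Fm → Fm → Fm          -- conjunction
  _⊻_  : Fm → Fm → Fm          -- disjunction
  _⇒_  : Fm → Fm → Fm
  _⇔_  : Fm → Fm → Fm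
  _△_  : Fm → Fm → Fm
  _↬_  : Fm → Fm → Fm

ERel : Set₁
ERel = Fm → Fm → Set

Val : Set
Val = ℕ → Bool

Sat : Val → ERel → Fm → Set
Sat v R (var p)  = v p ≡ true
Sat v R (¬' φ)   = ¬ Sat v R φ
Sat v R (φ ⊼ ψ)  = Sat v R φ × Sat v R ψ
Sat v R (φ ⊻ ψ)  = Sat v R φ ⊎ Sat v R ψ
Sat v R (φ ⇒ ψ)  = Sat v R φ → Sat v R ψ
Sat v R (φ ⇔ ψ)  = (Sat v R φ → Sat v R ψ) × (Sat v R ψ → Sat v R φ)
Sat v R (φ △ ψ)  = (Sat v R φ × Sat v R ψ) × R φ ψ
Sat v R (φ ↬ ψ)  = ((¬ Sat v R φ) ⊎ Sat v R ψ) × R φ ψ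

_⊨_ : ERel → Fm → Set
R ⊨ φ = ∀ (v : Val) → Sat v R φ

_⊨ₛ_ : (ERel → Set) → Fm → Set₁
X ⊨ₛ φ = ∀ (R : ERel) → X R → R ⊨ φ

-- Classical tautologies in this language: formulas true under every
-- Boolean assignment to letters and to △/↬-subformulas (treated as atoms).
evalB : (Fm → Bool) → Fm → Bool
evalB f (var p)  = f (var p)
evalB f (¬' φ)   = not (evalB f φ)
evalB f (φ ⊼ ψ)  = evalB f φ ∧ evalB f ψ
evalB f (φ ⊻ ψ)  = evalB f φ ∨ evalB f ψ
evalB f (φ ⇒ ψ)  = not (evalB f φ) ∨ evalB f ψ
evalB f (φ ⇔ ψ)  = (not (evalB f φ) ∨ evalB f ψ) ∧ (not (evalB f ψ) ∨ evalB f φ)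
evalB f (φ △ ψ)  = f (φ △ ψ)
evalB f (φ ↬ ψ)  = f (φ ↬ ψ)

Tautology : Fm → Set
Tautology φ = ∀ (f : Fm → Bool) → evalB f φ ≡ true

Subst : Set
Subst = ℕ → Fm

sub : Subst → Fm → Fm
sub σ (var p)  = σ p
sub σ (¬' φ)   = ¬' (sub σ φ)
sub σ (φ ⊼ ψ)  = sub σ φ ⊼ sub σ ψ
sub σ (φ ⊻ ψ)  = sub σ φ ⊻ sub σ ψ
sub σ (φ ⇒ ψ)  = sub σ φ ⇒ sub σ ψ
sub σ (φ ⇔ ψ)  = sub σ φ ⇔ sub σ ψ
sub σ (φ △ ψ)  = sub σ φ △ sub σ ψ
sub σ (φ ↬ ψ)  = sub σ φ ↬ sub σ ψ

data 𝓕 : Fm → Set where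
  taut : ∀ {φ} → Tautology φ → 𝓕 φ
  ax1  : ∀ {p q} → p ≢ q → 𝓕 ((var p ↬ var q) ⇒ (var p ⇒ var q))
  ax2  : ∀ {p q} → p ≢ q →
         𝓕 ((var p △ var q) ⇔ ((var p ↬ var q) ⊼ (var p ⊼ var q)))
  subst : ∀ {φ} (σ : Subst) → 𝓕 φ → 𝓕 (sub σ φ)
  mp   : ∀ {φ ψ} → 𝓕 (φ ⇒ ψ) → 𝓕 φ → 𝓕 ψ

record IsLogic (L : Fm → Set) : Set where
  field
    ⊇𝓕     : ∀ {φ} → 𝓕 φ → L φ
    closedSub : ∀ {φ} (σ : Subst) → L φ → L (sub σ φ)
    closedMP  : ∀ {φ ψ} → L (φ ⇒ ψ) → L φ → L ψ

EpsteinComplete : (Fm → Set) → Set₁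
EpsteinComplete L =
  Σ[ X ∈ (ERel → Set) ] (∀ φ → (L φ → X ⊨ₛ φ) × (X ⊨ₛ φ → L φ))

ECLogic : Set₁
ECLogic = Σ[ L ∈ (Fm → Set) ] (IsLogic L × EpsteinComplete L)

carrier : ECLogic → Fm → Set
carrier (L , _) = L

_≐_ : ECLogic → ECLogic → Set
A ≐ B = ∀ φ → (carrier A φ → carrier B φ) × (carrier B φ → carrier A φ)

-- For S ⊆ ℕ, consider the Epstein models whose relation links every formula φ to
-- ¬¬ⁿ n φ (φ preceded by n double negations) for each n ∈ S. The formula
-- p₀ ↬ ¬¬ⁿ n p₀ holds in all of them iff n ∈ S: since ¬¬ⁿ n p₀ is equivalent to p₀
-- its truth reduces to ⟨p₀, ¬¬ⁿ n p₀⟩ ∈ ℜ, and for n ∉ S the relation that links φ, ψ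
-- unless ψ has exactly n more leading double negations than φ is an admissible
-- countermodel. Hence S ↦ (logic of these models) is injective. Conversely formulas
-- are countable, so classically a logic is determined by the characteristic
-- sequence of the codes of its members.
module Submission where

open import Defs
open import Level using (0ℓ)
open import Data.Nat using (ℕ; zero; suc; _+_; _≟_)
open import Data.Nat.Properties using (+-cancelʳ-≡)
open import Data.Nat.Binary using (ℕᵇ; 2[1+_]; 1+[2_]; toℕ) renaming (zero to 0ᵇ)
open import Data.Nat.Binary.Properties using (2[1+_]-injective; 1+[2_]-injective; toℕ-injective)
open import Data.Bool using (Bool; true; false; not; _∧_; _∨_; T)
open import Data.Bool.Properties using (not-involutive; ∨-inverseˡ; T-≡)
open import Data.Tree.Binary using (Tree; leaf; node)
open import Data.Product using (Σ-syntax; ∃-syntax; _×_; _,_; proj₁; proj₂)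
open import Data.Sum using (inj₁; inj₂)
open import Data.Unit using (tt)
open import Data.Empty using (⊥-elim)
open import Function using (_∘_; Equivalence; Injective)
open import Relation.Nullary using (¬_)
open import Relation.Nullary.Reflects
  using (Reflects; ofʸ; ofⁿ; T-reflects; ¬-reflects; _×-reflects_; _⊎-reflects_; _→-reflects_)
open import Relation.Nullary.Decidable
  using (isYes; isNo; T?; decidable-stable; fromWitness; toWitness; fromWitnessFalse; toWitnessFalse)
open import Relation.Binary.PropositionalEquality using (_≡_; refl; sym; trans; cong; cong₂)
import Relation.Binary.PropositionalEquality as ≡
open import Axiom.ExcludedMiddle using (ExcludedMiddle)

BRel : Set
BRel = Fm → Fm → Bool

⟦_⟧ : Fm → Val → BRel → Bool
⟦ var p ⟧ v r = v p
⟦ ¬' φ ⟧ v r = not (⟦ φ ⟧ v r)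
⟦ φ ⊼ ψ ⟧ v r = ⟦ φ ⟧ v r ∧ ⟦ ψ ⟧ v r
⟦ φ ⊻ ψ ⟧ v r = ⟦ φ ⟧ v r ∨ ⟦ ψ ⟧ v r
⟦ φ ⇒ ψ ⟧ v r = not (⟦ φ ⟧ v r) ∨ ⟦ ψ ⟧ v r
⟦ φ ⇔ ψ ⟧ v r = (not (⟦ φ ⟧ v r) ∨ ⟦ ψ ⟧ v r) ∧ (not (⟦ ψ ⟧ v r) ∨ ⟦ φ ⟧ v r)
⟦ φ △ ψ ⟧ v r = (⟦ φ ⟧ v r ∧ ⟦ ψ ⟧ v r) ∧ r φ ψ
⟦ φ ↬ ψ ⟧ v r = (not (⟦ φ ⟧ v r) ∨ ⟦ ψ ⟧ v r) ∧ r φ ψ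

evalB-⟦⟧ : ∀ v r φ → evalB (λ χ → ⟦ χ ⟧ v r) φ ≡ ⟦ φ ⟧ v r
evalB-⟦⟧ v r (var p) = refl
evalB-⟦⟧ v r (¬' φ) = cong not (evalB-⟦⟧ v r φ)
evalB-⟦⟧ v r (φ ⊼ ψ) = cong₂ _∧_ (evalB-⟦⟧ v r φ) (evalB-⟦⟧ v r ψ)
evalB-⟦⟧ v r (φ ⊻ ψ) = cong₂ _∨_ (evalB-⟦⟧ v r φ) (evalB-⟦⟧ v r ψ)
evalB-⟦⟧ v r (φ ⇒ ψ) = cong₂ (λ a b → not a ∨ b) (evalB-⟦⟧ v r φ) (evalB-⟦⟧ v r ψ)
evalB-⟦⟧ v r (φ ⇔ ψ) =
  cong₂ (λ a b → (not a ∨ b) ∧ (not b ∨ a)) (evalB-⟦⟧ v r φ) (evalB-⟦⟧ v r ψ)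
evalB-⟦⟧ v r (φ △ ψ) = refl
evalB-⟦⟧ v r (φ ↬ ψ) = refl

Tautology⇒⟦⟧ : ∀ {φ} → Tautology φ → ∀ v r → T (⟦ φ ⟧ v r)
Tautology⇒⟦⟧ {φ} t v r =
  Equivalence.from T-≡ (trans (sym (evalB-⟦⟧ v r φ)) (t (λ χ → ⟦ χ ⟧ v r)))

≡true-reflects : ∀ b → Reflects (b ≡ true) b
≡true-reflects true = ofʸ refl
≡true-reflects false = ofⁿ λ ()

Sat-reflects : ∀ {R : ERel} {r : BRel} → (∀ φ ψ → Reflects (R φ ψ) (r φ ψ)) →
               ∀ v φ → Reflects (Sat v R φ) (⟦ φ ⟧ v r)
Sat-reflects R-r v (var p) = ≡true-reflects (v p)
Sat-reflects R-r v (¬' φ) = ¬-reflects (Sat-reflects R-r v φ)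
Sat-reflects R-r v (φ ⊼ ψ) = Sat-reflects R-r v φ ×-reflects Sat-reflects R-r v ψ
Sat-reflects R-r v (φ ⊻ ψ) = Sat-reflects R-r v φ ⊎-reflects Sat-reflects R-r v ψ
Sat-reflects R-r v (φ ⇒ ψ) = Sat-reflects R-r v φ →-reflects Sat-reflects R-r v ψ
Sat-reflects R-r v (φ ⇔ ψ) =
  (Sat-reflects R-r v φ →-reflects Sat-reflects R-r v ψ) ×-reflects
  (Sat-reflects R-r v ψ →-reflects Sat-reflects R-r v φ)
Sat-reflects R-r v (φ △ ψ) =
  (Sat-reflects R-r v φ ×-reflects Sat-reflects R-r v ψ) ×-reflects R-r φ ψ
Sat-reflects R-r v (φ ↬ ψ) =
  (¬-reflects (Sat-reflects R-r v φ) ⊎-reflects Sat-reflects R-r v ψ) ×-reflects R-r φ ψ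

reflects-A⇒T : ∀ {A : Set} {b} → Reflects A b → A → T b
reflects-A⇒T (ofʸ _) _ = tt
reflects-A⇒T (ofⁿ ¬a) a = ¬a a

reflects-T⇒A : ∀ {A : Set} {b} → Reflects A b → T b → A
reflects-T⇒A (ofʸ a) _ = a

subRel : Subst → BRel → BRel
subRel σ r φ ψ = r (sub σ φ) (sub σ ψ)

⟦sub⟧ : ∀ σ v r φ → ⟦ sub σ φ ⟧ v r ≡ ⟦ φ ⟧ (λ p → ⟦ σ p ⟧ v r) (subRel σ r)
⟦sub⟧ σ v r (var p) = refl
⟦sub⟧ σ v r (¬' φ) = cong not (⟦sub⟧ σ v r φ)
⟦sub⟧ σ v r (φ ⊼ ψ) = cong₂ _∧_ (⟦sub⟧ σ v r φ) (⟦sub⟧ σ v r ψ)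
⟦sub⟧ σ v r (φ ⊻ ψ) = cong₂ _∨_ (⟦sub⟧ σ v r φ) (⟦sub⟧ σ v r ψ)
⟦sub⟧ σ v r (φ ⇒ ψ) = cong₂ (λ a b → not a ∨ b) (⟦sub⟧ σ v r φ) (⟦sub⟧ σ v r ψ)
⟦sub⟧ σ v r (φ ⇔ ψ) =
  cong₂ (λ a b → (not a ∨ b) ∧ (not b ∨ a)) (⟦sub⟧ σ v r φ) (⟦sub⟧ σ v r ψ)
⟦sub⟧ σ v r (φ △ ψ) =
  cong₂ (λ a b → (a ∧ b) ∧ subRel σ r φ ψ) (⟦sub⟧ σ v r φ) (⟦sub⟧ σ v r ψ)
⟦sub⟧ σ v r (φ ↬ ψ) =
  cong₂ (λ a b → (not a ∨ b) ∧ subRel σ r φ ψ) (⟦sub⟧ σ v r φ) (⟦sub⟧ σ v r ψ)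

↬-elim-valid : ∀ v R φ ψ → Sat v R ((φ ↬ ψ) ⇒ (φ ⇒ ψ))
↬-elim-valid v R φ ψ (inj₁ ¬φ , _) φ̇ = ⊥-elim (¬φ φ̇)
↬-elim-valid v R φ ψ (inj₂ ψ̇ , _) _ = ψ̇

△-↬-valid : ∀ v R φ ψ → Sat v R ((φ △ ψ) ⇔ ((φ ↬ ψ) ⊼ (φ ⊼ ψ)))
△-↬-valid v R φ ψ =
  (λ { ((φ̇ , ψ̇) , ρ) → (inj₂ ψ̇ , ρ) , φ̇ , ψ̇ }) ,
  (λ { ((_ , ρ) , φ̇ , ψ̇) → (φ̇ , ψ̇) , ρ })

¬¬ⁿ : ℕ → Fm → Fm
¬¬ⁿ zero φ = φ
¬¬ⁿ (suc n) φ = ¬' (¬' (¬¬ⁿ n φ))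

sub-¬¬ⁿ : ∀ σ n φ → sub σ (¬¬ⁿ n φ) ≡ ¬¬ⁿ n (sub σ φ)
sub-¬¬ⁿ σ zero φ = refl
sub-¬¬ⁿ σ (suc n) φ = cong (¬' ∘ ¬') (sub-¬¬ⁿ σ n φ)

⟦¬¬ⁿ⟧ : ∀ n φ v r → ⟦ ¬¬ⁿ n φ ⟧ v r ≡ ⟦ φ ⟧ v r
⟦¬¬ⁿ⟧ zero φ v r = refl
⟦¬¬ⁿ⟧ (suc n) φ v r = trans (not-involutive (⟦ ¬¬ⁿ n φ ⟧ v r)) (⟦¬¬ⁿ⟧ n φ v r)

¬¬-prefix : Fm → ℕ
¬¬-prefix (¬' (¬' φ)) = suc (¬¬-prefix φ)
¬¬-prefix _ = zero

¬¬-prefix-¬¬ⁿ : ∀ n φ → ¬¬-prefix (¬¬ⁿ n φ) ≡ n + ¬¬-prefix φ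
¬¬-prefix-¬¬ⁿ zero φ = refl
¬¬-prefix-¬¬ⁿ (suc n) φ = cong suc (¬¬-prefix-¬¬ⁿ n φ)

Admissible : (ℕ → Bool) → BRel → Set
Admissible s r = ∀ n → T (s n) → ∀ φ → T (r φ (¬¬ⁿ n φ))

admissible-subRel : ∀ s σ r → Admissible s r → Admissible s (subRel σ r)
admissible-subRel s σ r adm n n∈s φ =
  ≡.subst (T ∘ r (sub σ φ)) (sym (sub-¬¬ⁿ σ n φ)) (adm n n∈s (sub σ φ))

Λ : (ℕ → Bool) → Fm → Set
Λ s φ = ∀ r → Admissible s r → ∀ v → T (⟦ φ ⟧ v r)

Models : (ℕ → Bool) → ERel → Set
Models s R = Σ[ r ∈ BRel ] ((∀ φ ψ → Reflects (R φ ψ) (r φ ψ)) × Admissible s r)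

Λ⇒⊨ : ∀ s φ → Λ s φ → Models s ⊨ₛ φ
Λ⇒⊨ s φ φ∈Λ R (r , R-r , adm) v =
  reflects-T⇒A (Sat-reflects R-r v φ) (φ∈Λ r adm v)

⊨⇒Λ : ∀ s φ → Models s ⊨ₛ φ → Λ s φ
⊨⇒Λ s φ ⊨φ r adm v =
  reflects-A⇒T (Sat-reflects R-r v φ) (⊨φ (λ φ ψ → T (r φ ψ)) (r , R-r , adm) v)
  where
  R-r : ∀ φ ψ → Reflects (T (r φ ψ)) (r φ ψ)
  R-r φ ψ = T-reflects (r φ ψ)

Λ-sub : ∀ s {φ} σ → Λ s φ → Λ s (sub σ φ)
Λ-sub s {φ} σ φ∈Λ r adm v =
  ≡.subst T (sym (⟦sub⟧ σ v r φ))
    (φ∈Λ (subRel σ r) (admissible-subRel s σ r adm) (λ p → ⟦ σ p ⟧ v r))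

Λ-mp : ∀ s {φ ψ} → Λ s (φ ⇒ ψ) → Λ s φ → Λ s ψ
Λ-mp s {φ} {ψ} φ⇒ψ∈Λ φ∈Λ =
  ⊨⇒Λ s ψ λ R m v → Λ⇒⊨ s (φ ⇒ ψ) φ⇒ψ∈Λ R m v (Λ⇒⊨ s φ φ∈Λ R m v)

𝓕⊆Λ : ∀ s {φ} → 𝓕 φ → Λ s φ
𝓕⊆Λ s (taut {φ} t) r _ v = Tautology⇒⟦⟧ {φ} t v r
𝓕⊆Λ s (ax1 {p} {q} _) = ⊨⇒Λ s ((var p ↬ var q) ⇒ (var p ⇒ var q)) λ R _ v → ↬-elim-valid v R (var p) (var q)
𝓕⊆Λ s (ax2 {p} {q} _) = ⊨⇒Λ s ((var p △ var q) ⇔ ((var p ↬ var q) ⊼ (var p ⊼ var q))) λ R _ v → △-↬-valid v R (var p) (var q)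
𝓕⊆Λ s (subst {φ} σ d) = Λ-sub s {φ} σ (𝓕⊆Λ s d)
𝓕⊆Λ s (mp {φ} {ψ} d e) = Λ-mp s {φ} {ψ} (𝓕⊆Λ s d) (𝓕⊆Λ s e)

Λ-isLogic : ∀ s → IsLogic (Λ s)
Λ-isLogic s = record
  { ⊇𝓕 = 𝓕⊆Λ s
  ; closedSub = λ {φ} → Λ-sub s {φ}
  ; closedMP = λ {φ} {ψ} → Λ-mp s {φ} {ψ}
  }

Λ-epsteinComplete : ∀ s → EpsteinComplete (Λ s)
Λ-epsteinComplete s = Models s , λ φ → Λ⇒⊨ s φ , ⊨⇒Λ s φ

logicOf : (ℕ → Bool) → ECLogic
logicOf s = Λ s , Λ-isLogic s , Λ-epsteinComplete s

probe : ℕ → Fm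
probe n = var 0 ↬ ¬¬ⁿ n (var 0)

T⇒probe∈Λ : ∀ s n → T (s n) → Λ s (probe n)
T⇒probe∈Λ s n n∈s r adm v rewrite ⟦¬¬ⁿ⟧ n (var 0) v r | ∨-inverseˡ (v 0) =
  adm n n∈s (var 0)

separator : ℕ → BRel
separator n φ ψ = isNo (¬¬-prefix ψ ≟ n + ¬¬-prefix φ)

separator-admissible : ∀ s n → ¬ T (s n) → Admissible s (separator n)
separator-admissible s n n∉s m m∈s φ = fromWitnessFalse λ m+k≡n+k →
  n∉s (≡.subst (T ∘ s)
    (+-cancelʳ-≡ (¬¬-prefix φ) m n (trans (sym (¬¬-prefix-¬¬ⁿ m φ)) m+k≡n+k)) m∈s)

-- Under the all-false valuation the probe's truth value is just the relation's value.
probe∈Λ⇒T : ∀ s n → Λ s (probe n) → T (s n)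
probe∈Λ⇒T s n probe∈Λ = decidable-stable (T? (s n)) λ n∉s →
  toWitnessFalse (probe∈Λ (separator n) (separator-admissible s n n∉s) (λ _ → false))
    (¬¬-prefix-¬¬ⁿ n (var 0))

T-injective : ∀ {a b} → (T a → T b) → (T b → T a) → a ≡ b
T-injective {false} {false} _ _ = refl
T-injective {false} {true} _ b⇒a = ⊥-elim (b⇒a tt)
T-injective {true} {false} a⇒b _ = ⊥-elim (a⇒b tt)
T-injective {true} {true} _ _ = refl

logicOf-injective : ∀ s t → logicOf s ≐ logicOf t → ∀ n → s n ≡ t n
logicOf-injective s t s≐t n = T-injective
  (probe∈Λ⇒T t n ∘ proj₁ (s≐t (probe n)) ∘ T⇒probe∈Λ s n)
  (probe∈Λ⇒T s n ∘ proj₂ (s≐t (probe n)) ∘ T⇒probe∈Λ t n)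

-- Bit strings are written into ℕᵇ, using 1+[2_] and 2[1+_] as the bits 0 and 1.
writeUnary : ℕ → ℕᵇ → ℕᵇ
writeUnary zero b = 1+[2 b ]
writeUnary (suc n) b = 2[1+ writeUnary n b ]

writeTree : Tree ℕ ℕ → ℕᵇ → ℕᵇ
writeTree (leaf n) b = 1+[2 writeUnary n b ]
writeTree (node l k r) b = 2[1+ writeUnary k (writeTree l (writeTree r b)) ]

writeUnary-injective : ∀ m n {b c} → writeUnary m b ≡ writeUnary n c → m ≡ n × b ≡ c
writeUnary-injective zero zero eq = refl , 1+[2_]-injective eq
writeUnary-injective (suc m) (suc n) eq with writeUnary-injective m n (2[1+_]-injective eq)
... | refl , b≡c = refl , b≡c

writeTree-injective : ∀ s t {b c} → writeTree s b ≡ writeTree t c → s ≡ t × b ≡ c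
writeTree-injective (leaf m) (leaf n) eq with writeUnary-injective m n (1+[2_]-injective eq)
... | refl , b≡c = refl , b≡c
writeTree-injective (node l k r) (node l′ k′ r′) eq
  with writeUnary-injective k k′ (2[1+_]-injective eq)
... | refl , eqₗ with writeTree-injective l l′ eqₗ
... | refl , eqᵣ with writeTree-injective r r′ eqᵣ
... | refl , b≡c = refl , b≡c

treeCode : Tree ℕ ℕ → ℕ
treeCode t = toℕ (writeTree t 0ᵇ)

treeCode-injective : Injective _≡_ _≡_ treeCode
treeCode-injective {s} {t} = proj₁ ∘ writeTree-injective s t ∘ toℕ-injective

toTree : Fm → Tree ℕ ℕ
toTree (var n) = leaf n
toTree (¬' φ) = node (toTree φ) 0 (toTree φ)
toTree (φ ⊼ ψ) = node (toTree φ) 1 (toTree ψ)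
toTree (φ ⊻ ψ) = node (toTree φ) 2 (toTree ψ)
toTree (φ ⇒ ψ) = node (toTree φ) 3 (toTree ψ)
toTree (φ ⇔ ψ) = node (toTree φ) 4 (toTree ψ)
toTree (φ △ ψ) = node (toTree φ) 5 (toTree ψ)
toTree (φ ↬ ψ) = node (toTree φ) 6 (toTree ψ)

fromTree : Tree ℕ ℕ → Fm
fromTree (leaf n) = var n
fromTree (node l 0 r) = ¬' (fromTree l)
fromTree (node l 1 r) = fromTree l ⊼ fromTree r
fromTree (node l 2 r) = fromTree l ⊻ fromTree r
fromTree (node l 3 r) = fromTree l ⇒ fromTree r
fromTree (node l 4 r) = fromTree l ⇔ fromTree r
fromTree (node l 5 r) = fromTree l △ fromTree r
fromTree (node l 6 r) = fromTree l ↬ fromTree r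
fromTree (node l _ r) = var 0

fromTree-toTree : ∀ φ → fromTree (toTree φ) ≡ φ
fromTree-toTree (var n) = refl
fromTree-toTree (¬' φ) = cong ¬' (fromTree-toTree φ)
fromTree-toTree (φ ⊼ ψ) = cong₂ _⊼_ (fromTree-toTree φ) (fromTree-toTree ψ)
fromTree-toTree (φ ⊻ ψ) = cong₂ _⊻_ (fromTree-toTree φ) (fromTree-toTree ψ)
fromTree-toTree (φ ⇒ ψ) = cong₂ _⇒_ (fromTree-toTree φ) (fromTree-toTree ψ)
fromTree-toTree (φ ⇔ ψ) = cong₂ _⇔_ (fromTree-toTree φ) (fromTree-toTree ψ)
fromTree-toTree (φ △ ψ) = cong₂ _△_ (fromTree-toTree φ) (fromTree-toTree ψ)
fromTree-toTree (φ ↬ ψ) = cong₂ _↬_ (fromTree-toTree φ) (fromTree-toTree ψ)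

code : Fm → ℕ
code = treeCode ∘ toTree

code-injective : Injective _≡_ _≡_ code
code-injective {φ} {ψ} eq = begin
  φ                   ≡⟨ sym (fromTree-toTree φ) ⟩
  fromTree (toTree φ) ≡⟨ cong fromTree (treeCode-injective eq) ⟩
  fromTree (toTree ψ) ≡⟨ fromTree-toTree ψ ⟩
  ψ                   ∎
  where open ≡.≡-Reasoning

module _ (lem : ExcludedMiddle 0ℓ) {A : Set} {enc : A → ℕ} (enc-injective : Injective _≡_ _≡_ enc) where

  χ : (A → Set) → ℕ → Bool
  χ P n = isYes (lem {∃[ a ] enc a ≡ n × P a})

  χ-≡⇒⊆ : ∀ P Q → (∀ n → χ P n ≡ χ Q n) → ∀ a → P a → Q a
  χ-≡⇒⊆ P Q χP≡χQ a Pa with toWitness (≡.subst T (χP≡χQ (enc a)) (fromWitness (a , refl , Pa)))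
  ... | b , eb≡ea , Qb = ≡.subst Q (enc-injective eb≡ea) Qb

mainTheorem3 :
    (Σ[ f ∈ ((ℕ → Bool) → ECLogic) ]
       (∀ s t → f s ≐ f t → ∀ n → s n ≡ t n))
    ×
    (ExcludedMiddle 0ℓ →
      Σ[ g ∈ (ECLogic → ℕ → Bool) ]
        (∀ A B → (∀ n → g A n ≡ g B n) → A ≐ B))
mainTheorem3 = (logicOf , logicOf-injective) , λ lem →
  (λ A → χ lem code-injective (carrier A)) ,
  λ A B χA≡χB φ →
    χ-≡⇒⊆ lem code-injective (carrier A) (carrier B) χA≡χB φ ,
    χ-≡⇒⊆ lem code-injective (carrier B) (carrier A) (sym ∘ χA≡χB) φ
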